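{- Let $q$ be a prime power, $n,m\ge 2$, let $C\le\mathbb{F}_{q^m}^n$ be a code of dimension $k\ge1$ and minimum rank distance $d$, and let $i\in\{1,\dots,n\}$. The following are equivalent: (1) $\ell_k^{(i)}(C)=\ell_1^{(i)}(C)+k-1=\lceil d/i\rceil+k-1$ (i.e., $C$ is $i$-lattice-optimal); (2) $\ell_j^{(i)}(C)=\ell_1^{(i)}(C)+j-1$ for all $j\in\{1,\dots,k\}$.
   Context: A code is an $\mathbb{F}_{q^m}$-linear subspace of $\mathbb{F}_{q^m}^n$. The rank of $v\in\mathbb{F}_{q^m}^n$ is the $\mathbb{F}_q$-dimension of the $\mathbb{F}_q$-span of its entries; $d=\min\{\mathrm{rk}(c):0\ne c\in C\}$. For $i\in\{1,\dots,n\}$, $\mathscr{L}_i(n,m;q)$ is the set of $\mathbb{F}_{q^m}$-subspaces of $\mathbb{F}_{q^m}^n$ spanned by vectors of rank at most $i$ (including $\{0\}$). The $(i,j)$-th lattice-rank weight is $\ell_j^{(i)}(C)=\min\{\dim_{\mathbb{F}_{q^m}}X: X\in\mathscr{L}_i(n,m;q),\ \dim_{\mathbb{F}_{q^m}}(C\cap X)\ge j\}$. -}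

module Defs where

open import Level using (0ℓ)
open import Data.Nat as ℕ using (ℕ; zero; suc; _≤_; _∸_; _/_)
open import Data.Nat.Primality using (Prime)
open import Data.Fin using (Fin) renaming (zero to fzero; suc to fsuc)
open import Data.Product using (Σ; ∃; ∃-syntax; _×_; _,_)
open import Data.Unit using (⊤)
open import Relation.Nullary using (¬_)
open import Relation.Binary.PropositionalEquality using (_≡_)
open import Function.Definitions using (Injective)
open import Algebra.Structures using (IsCommutativeRing)

IsPrimePower : ℕ → Set
IsPrimePower q = Σ ℕ λ p → Σ ℕ λ e → Prime p × q ≡ p ℕ.^ suc e

-- ⌈ d / i ⌉ for i ≥ 1 (value at i = 0 is irrelevant and set to 0)
ceilDiv : ℕ → ℕ → ℕ
ceilDiv d zero    = 0
ceilDiv d (suc i) = (d ℕ.+ i) / suc i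

record Field : Set₁ where
  infixl 6 _+_
  infixl 7 _*_
  field
    Carrier    : Set
    _+_ _*_    : Carrier → Carrier → Carrier
    -_         : Carrier → Carrier
    0# 1#      : Carrier
    isCommutativeRing : IsCommutativeRing _≡_ _+_ _*_ -_ 0# 1#
    1≢0        : ¬ (1# ≡ 0#)
    inverse    : ∀ x → ¬ (x ≡ 0#) → ∃[ y ] (x * y ≡ 1#)

-- Linear algebra over a field L, with scalars restricted to a predicate S
-- (S = everything: L-linear algebra;  S = subfield K: K-linear algebra)

module LinAlg (L : Field) where
  open Field L

  Vector : ℕ → Set
  Vector t = Fin t → Carrier

  _≋_ : ∀ {t} → Vector t → Vector t → Set
  u ≋ v = ∀ a → u a ≡ v a

  zeroV : ∀ {t} → Vector t
  zeroV _ = 0#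

  _⊕_ : ∀ {t} → Vector t → Vector t → Vector t
  (u ⊕ v) a = u a + v a

  _·_ : ∀ {t} → Carrier → Vector t → Vector t
  (c · v) a = c * v a

  lincomb : ∀ {t r} → (Fin r → Carrier) → (Fin r → Vector t) → Vector t
  lincomb {r = zero}  c w = zeroV
  lincomb {r = suc r} c w = (c fzero · w fzero) ⊕ lincomb (λ a → c (fsuc a)) (λ a → w (fsuc a))

  Scalars : Set₁
  Scalars = Carrier → Set

  AllScalars : Scalars
  AllScalars _ = ⊤

  Sub : ℕ → Set₁
  Sub t = Vector t → Set

  InSpan : ∀ {t r} → Scalars → (Fin r → Vector t) → Sub t
  InSpan {r = r} S w v = Σ (Fin r → Carrier) λ c → (∀ a → S (c a)) × (v ≋ lincomb c w)

  Independent : ∀ {t r} → Scalars → (Fin r → Vector t) → Set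
  Independent {r = r} S w =
    ∀ (c : Fin r → Carrier) → (∀ a → S (c a)) → lincomb c w ≋ zeroV → ∀ a → c a ≡ 0#

  IsBasisOf : ∀ {t r} → Scalars → Sub t → (Fin r → Vector t) → Set
  IsBasisOf S X w = (∀ a → X (w a)) × Independent S w × (∀ v → X v → InSpan S w v)

  HasDim : ∀ {t} → Scalars → Sub t → ℕ → Set
  HasDim {t} S X a = Σ (Fin a → Vector t) λ w → IsBasisOf S X w

  IsSubspace : ∀ {t} → Sub t → Set
  IsSubspace X = X zeroV
               × (∀ u v → X u → X v → X (u ⊕ v))
               × (∀ c v → X v → X (c · v))
               × (∀ u v → u ≋ v → X u → X v)

  _∩_ : ∀ {t} → Sub t → Sub t → Sub t
  (X ∩ Y) v = X v × Y v

  DimAtLeast : ∀ {t} → Sub t → ℕ → Set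
  DimAtLeast X j = ∃[ a ] (j ≤ a × HasDim AllScalars X a)

  module Rank (K : Scalars) where

    -- entries of v viewed as elements of L = L^1
    entries : ∀ {n} → Vector n → Fin n → Vector 1
    entries v a _ = v a

    HasRank : ∀ {n} → Vector n → ℕ → Set
    HasRank v r = HasDim K (InSpan K (entries v)) r

    RankAtMost : ∀ {n} → ℕ → Vector n → Set
    RankAtMost i v = ∃[ r ] (r ≤ i × HasRank v r)

    InLattice : ∀ {n} → ℕ → Sub n → Set
    InLattice {n} i X =
      Σ ℕ λ r → Σ (Fin r → Vector n) λ g →
        (∀ a → RankAtMost i (g a)) ×
        (∀ v → (X v → InSpan AllScalars g v) × (InSpan AllScalars g v → X v))

    IsMinRankDistance : ∀ {n} → Sub n → ℕ → Set
    IsMinRankDistance C d =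
      (∃[ c ] (C c × ¬ (c ≋ zeroV) × HasRank c d)) ×
      (∀ c r → C c → ¬ (c ≋ zeroV) → HasRank c r → d ≤ r)

    IsLatticeRankWeight : ∀ {n} → Sub n → ℕ → ℕ → ℕ → Set₁
    IsLatticeRankWeight C i j w =
      (Σ (Sub _) λ X → InLattice i X × HasDim AllScalars X w × DimAtLeast (C ∩ X) j) ×
      (∀ (X : Sub _) a → InLattice i X → HasDim AllScalars X a → DimAtLeast (C ∩ X) j → w ≤ a)

-- L = F_{q^m} together with its subfield K = F_q (|K| = q, [L:K] = m)

record SubfieldExtension (L : Field) (q m : ℕ) : Set where
  open Field L
  open LinAlg L
  field
    ι       : Fin q → Carrier
    ι-inj   : Injective _≡_ _≡_ ι
  K : Scalars
  K x = ∃[ a ] (ι a ≡ x)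
  field
    K-0     : K 0#
    K-1     : K 1#
    K-+     : ∀ x y → K x → K y → K (x + y)
    K-*     : ∀ x y → K x → K y → K (x * y)
    K-neg   : ∀ x → K x → K (- x)
    K-inv   : ∀ x y → K x → x * y ≡ 1# → K y
    -- L has K-dimension m (elements of L viewed as vectors of length 1)
    degree  : HasDim K (λ (_ : Vector 1) → ⊤) m

-- ℓ₁⁽ⁱ⁾(C) = ⌈d/i⌉: a codeword of rank d is a sum of ⌈d/i⌉ vectors of rank ≤ i, whose span lies in 𝓛ᵢ;
-- conversely every X ∈ 𝓛ᵢ of dimension a has a basis of vectors of rank ≤ i, so each codeword in X has
-- rank ≤ a·i. Moreover ℓⱼ < ℓⱼ₊₁: dropping one low-rank basis vector of an optimal X for ℓⱼ₊₁ costs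
-- C ∩ X at most one dimension (Steinitz exchange), leaving a space in 𝓛ᵢ of one dimension less that
-- still meets C in dimension ≥ j. A strictly increasing sequence with ℓₖ = ℓ₁ + k − 1 rises by exactly
-- one at each step, which is (1) ⇒ (2); (2) ⇒ (1) is ℓ₁ = ⌈d/i⌉.
-- Since 𝔽_{q^m} is finite, membership in a span is decidable by exhaustive search, so bases can be
-- extracted from spanning families constructively.

module Submission where

open import Defs
open import Level using (0ℓ)
open import Algebra.Bundles using (CommutativeRing)
import Algebra.Properties.Ring as RingProperties
import Algebra.Properties.CommutativeSemigroup as CommutativeSemigroupProperties
open import Data.Nat as ℕ using (ℕ; zero; suc; _≤_; _<_; _≤?_; z≤n; s≤s; _∸_)
import Data.Nat.Properties as ℕ
open import Data.Nat.DivMod using (_/_; _%_; m≡m%n+[m/n]*n; m%n<n; m<n*o⇒m/o<n)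
open import Data.Fin as Fin using (Fin; punchIn; _↑ˡ_; _↑ʳ_) renaming (zero to fzero; suc to fsuc)
import Data.Fin.Properties as Fin
open import Data.Vec.Functional using (_∷_; _++_; tail; insertAt; removeAt)
open import Data.Vec.Functional.Relation.Unary.All.Properties using (++⁺)
open import Data.Vec.Functional.Properties using (lookup-++ˡ; lookup-++ʳ; insertAt-lookup; insertAt-punchIn)
open import Data.Product using (Σ; ∃; ∃-syntax; _×_; _,_; proj₁; proj₂)
open import Relation.Binary.PropositionalEquality hiding ([_])
open import Function using (_∘_)
open import Data.Empty using (⊥-elim)
open import Relation.Nullary using (¬_; Dec; yes; no; ¬?; _×-dec_)
open import Relation.Nullary.Decidable using (decidable-stable; map′)
open import Relation.Binary.Definitions using (DecidableEquality)
open import Data.List as List using (List; [_]; cartesianProductWith; allFin; filter)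
open import Data.List.Membership.Propositional using (_∈_; find; lose)
open import Data.List.Membership.Propositional.Properties
  using (∈-map⁺; ∈-map⁻; ∈-cartesianProductWith⁺; ∈-allFin; ∈-filter⁺; ∈-filter⁻; ∈-lookup)
open import Data.List.Relation.Unary.Any using (any?; here; index)
open import Data.List.Relation.Unary.Any.Properties using (lookup-index)
open import Data.Unit using (tt)
open import Function.Bundles using (_⇔_; mk⇔)

module FieldAlgebra (L : Field) where
  open Field L

  commutativeRing : CommutativeRing 0ℓ 0ℓ
  commutativeRing = record
    { _≈_ = _≡_ ; _+_ = _+_ ; _*_ = _*_ ; -_ = -_ ; 0# = 0# ; 1# = 1#
    ; isCommutativeRing = isCommutativeRing }

  open CommutativeRing commutativeRing public
    using ( +-assoc; +-comm; +-identityˡ; +-identityʳ; -‿inverseʳ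
          ; *-assoc; *-comm; *-identityˡ; *-identityʳ; distribˡ; distribʳ; zeroˡ; zeroʳ)
  open RingProperties (CommutativeRing.ring commutativeRing) public
    using (-‿distribˡ-*; -‿distribʳ-*; +-inverseˡ-unique; y≈x\\z; \\-leftDividesˡ)
  open CommutativeSemigroupProperties (CommutativeRing.+-commutativeSemigroup commutativeRing) public
    using () renaming (interchange to +-interchange; x∙yz≈y∙xz to x+yz≈y+xz)
  open CommutativeSemigroupProperties (CommutativeRing.*-commutativeSemigroup commutativeRing) public
    using () renaming (x∙yz≈y∙xz to x*yz≈y*xz)

module LinearCombinations (L : Field) where
  open Field L
  open LinAlg L
  open FieldAlgebra L
  open ≡-Reasoning

  lincomb-cong : ∀ {t r} {c c′ : Fin r → Carrier} {w w′ : Fin r → Vector t} →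
                 (∀ b → c b ≡ c′ b) → (∀ b → w b ≋ w′ b) → lincomb c w ≋ lincomb c′ w′
  lincomb-cong {r = zero}  c≡c′ w≋w′ a = refl
  lincomb-cong {r = suc r} c≡c′ w≋w′ a =
    cong₂ _+_ (cong₂ _*_ (c≡c′ fzero) (w≋w′ fzero a)) (lincomb-cong (c≡c′ ∘ fsuc) (w≋w′ ∘ fsuc) a)

  lincomb-zero : ∀ {t r} (w : Fin r → Vector t) → lincomb (λ _ → 0#) w ≋ zeroV
  lincomb-zero {r = zero}  w a = refl
  lincomb-zero {r = suc r} w a =
    trans (cong₂ _+_ (zeroˡ (w fzero a)) (lincomb-zero (tail w) a)) (+-identityˡ 0#)

  lincomb-+ : ∀ {t r} (c c′ : Fin r → Carrier) (w : Fin r → Vector t) →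
              lincomb (λ b → c b + c′ b) w ≋ (lincomb c w ⊕ lincomb c′ w)
  lincomb-+ {r = zero}  c c′ w a = sym (+-identityˡ 0#)
  lincomb-+ {r = suc r} c c′ w a =
    trans (cong₂ _+_ (distribʳ (w fzero a) (c fzero) (c′ fzero)) (lincomb-+ (tail c) (tail c′) (tail w) a))
          (+-interchange _ _ _ _)

  lincomb-*ˡ : ∀ {t r} x (c : Fin r → Carrier) (w : Fin r → Vector t) →
               lincomb (λ b → x * c b) w ≋ (x · lincomb c w)
  lincomb-*ˡ {r = zero}  x c w a = sym (zeroʳ x)
  lincomb-*ˡ {r = suc r} x c w a =
    trans (cong₂ _+_ (*-assoc x (c fzero) (w fzero a)) (lincomb-*ˡ x (tail c) (tail w) a))
          (sym (distribˡ x _ _))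

  lincomb-·ʳ : ∀ {t r} x (c : Fin r → Carrier) (w : Fin r → Vector t) →
               lincomb c (λ b → x · w b) ≋ (x · lincomb c w)
  lincomb-·ʳ {r = zero}  x c w a = sym (zeroʳ x)
  lincomb-·ʳ {r = suc r} x c w a =
    trans (cong₂ _+_ (x*yz≈y*xz (c fzero) x (w fzero a)) (lincomb-·ʳ x (tail c) (tail w) a))
          (sym (distribˡ x _ _))

  lincomb-removeAt : ∀ {t r} (c : Fin (suc r) → Carrier) (w : Fin (suc r) → Vector t) b →
                     lincomb c w ≋ ((c b · w b) ⊕ lincomb (removeAt c b) (removeAt w b))
  lincomb-removeAt c w fzero a = refl
  lincomb-removeAt {r = suc r} c w (fsuc b) a =
    trans (cong (c fzero * w fzero a +_) (lincomb-removeAt (tail c) (tail w) b a)) (x+yz≈y+xz _ _ _)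

  unit : ∀ {r} → Fin r → Fin r → Carrier
  unit {suc r} b = insertAt (λ _ → 0#) b 1#

  lincomb-unit : ∀ {t r} (w : Fin r → Vector t) b → lincomb (unit b) w ≋ w b
  lincomb-unit {r = suc r} w b a = begin
    lincomb (unit b) w a
      ≡⟨ lincomb-removeAt (unit b) w b a ⟩
    unit b b * w b a + lincomb (removeAt (unit b) b) (removeAt w b) a
      ≡⟨ cong₂ _+_ (cong (_* w b a) (insertAt-lookup _ b 1#))
                   (lincomb-cong (insertAt-punchIn _ b 1#) (λ _ _ → refl) a) ⟩
    1# * w b a + lincomb (λ _ → 0#) (removeAt w b) a
      ≡⟨ cong₂ _+_ (*-identityˡ (w b a)) (lincomb-zero (removeAt w b) a) ⟩
    w b a + 0#
      ≡⟨ +-identityʳ (w b a) ⟩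
    w b a ∎

  lincomb-split : ∀ {t} i {d} (c : Fin (i ℕ.+ d) → Carrier) (w : Fin (i ℕ.+ d) → Vector t) →
                  lincomb c w ≋ (lincomb (c ∘ (_↑ˡ d)) (w ∘ (_↑ˡ d)) ⊕ lincomb (c ∘ (i ↑ʳ_)) (w ∘ (i ↑ʳ_)))
  lincomb-split zero    c w a = sym (+-identityˡ _)
  lincomb-split (suc i) c w a =
    trans (cong (c fzero * w fzero a +_) (lincomb-split i (tail c) (tail w) a)) (sym (+-assoc _ _ _))

  lincomb-++ : ∀ {t r r′} (c : Fin r → Carrier) (c′ : Fin r′ → Carrier) (w : Fin r → Vector t) w′ →
               lincomb (c ++ c′) (w ++ w′) ≋ (lincomb c w ⊕ lincomb c′ w′)
  lincomb-++ {r = r} c c′ w w′ a =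
    trans (lincomb-split r (c ++ c′) (w ++ w′) a)
          (cong₂ _+_ (lincomb-cong (lookup-++ˡ c c′) (λ b → cong-app (lookup-++ˡ w w′ b)) a)
                     (lincomb-cong (lookup-++ʳ c c′) (λ b → cong-app (lookup-++ʳ w w′ b)) a))

  dot : ∀ {r} → (Fin r → Carrier) → (Fin r → Carrier) → Carrier
  dot e κ = lincomb e (λ b (_ : Fin 1) → κ b) fzero

  lincomb-shear : ∀ {t r} (e κ : Fin r → Carrier) (u : Fin r → Vector t) (z : Vector t) →
                  lincomb e (λ b → u b ⊕ (κ b · z)) ≋ (lincomb e u ⊕ (dot e κ · z))
  lincomb-shear {r = zero}  e κ u z a = sym (trans (cong (0# +_) (zeroˡ (z a))) (+-identityˡ 0#))
  lincomb-shear {r = suc r} e κ u z a = begin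
    e₀ * (u fzero a + κ fzero * z a) + lincomb (tail e) (λ b → tail u b ⊕ (tail κ b · z)) a
      ≡⟨ cong₂ _+_ (trans (distribˡ _ _ _) (cong (e₀ * u fzero a +_) (sym (*-assoc _ _ _))))
                   (lincomb-shear (tail e) (tail κ) (tail u) z a) ⟩
    (e₀ * u fzero a + (e₀ * κ fzero) * z a) + (lincomb (tail e) (tail u) a + dot (tail e) (tail κ) * z a)
      ≡⟨ +-interchange _ _ _ _ ⟩
    (e₀ * u fzero a + lincomb (tail e) (tail u) a) + ((e₀ * κ fzero) * z a + dot (tail e) (tail κ) * z a)
      ≡⟨ cong (lincomb e u a +_) (sym (distribʳ _ _ _)) ⟩
    lincomb e u a + dot e κ * z a ∎
    where
    e₀ : Carrier
    e₀ = e fzero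

insertAt⁺ : ∀ {A : Set} {P : A → Set} {n} {xs : Fin n → A} i {v} →
            (∀ j → P (xs j)) → P v → ∀ j → P (insertAt xs i v j)
insertAt⁺ fzero    ps pv fzero    = pv
insertAt⁺ fzero    ps pv (fsuc j) = ps j
insertAt⁺ {n = suc n} (fsuc i) ps pv fzero    = ps fzero
insertAt⁺ {P = P} {n = suc n} (fsuc i) ps pv (fsuc j) = insertAt⁺ {P = P} i (ps ∘ fsuc) pv j

module Spans (L : Field) (_≟_ : DecidableEquality (Field.Carrier L)) where
  open Field L
  open LinAlg L
  open FieldAlgebra L
  open LinearCombinations L
  open ≡-Reasoning

  record IsFiniteSubfield (S : Scalars) : Set where
    field
      S-0   : S 0#
      S-1   : S 1#
      S-+   : ∀ {x y} → S x → S y → S (x + y)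
      S-*   : ∀ {x y} → S x → S y → S (x * y)
      S-neg : ∀ {x} → S x → S (- x)
      S-inv : ∀ {x y} → S x → x * y ≡ 1# → S y
      elements          : List Carrier
      elements-sound    : ∀ {x} → x ∈ elements → S x
      elements-complete : ∀ {x} → S x → x ∈ elements

  module FiniteSpans {S : Scalars} (S-finite : IsFiniteSubfield S) where
    open IsFiniteSubfield S-finite

    span-zero : ∀ {t r} (w : Fin r → Vector t) → InSpan S w zeroV
    span-zero w = (λ _ → 0#) , (λ _ → S-0) , (λ a → sym (lincomb-zero w a))

    span-⊕ : ∀ {t r} (w : Fin r → Vector t) {u v} → InSpan S w u → InSpan S w v → InSpan S w (u ⊕ v)
    span-⊕ w (c , cs , e) (c′ , cs′ , e′) =
      (λ b → c b + c′ b) , (λ b → S-+ (cs b) (cs′ b)) ,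
      (λ a → trans (cong₂ _+_ (e a) (e′ a)) (sym (lincomb-+ c c′ w a)))

    span-· : ∀ {t r} (w : Fin r → Vector t) {v} x → S x → InSpan S w v → InSpan S w (x · v)
    span-· w x sx (c , cs , e) =
      (λ b → x * c b) , (λ b → S-* sx (cs b)) , (λ a → trans (cong (x *_) (e a)) (sym (lincomb-*ˡ x c w a)))

    span-resp : ∀ {t r} (w : Fin r → Vector t) {u v} → u ≋ v → InSpan S w u → InSpan S w v
    span-resp w u≋v (c , cs , e) = c , cs , (λ a → trans (sym (u≋v a)) (e a))

    unit∈S : ∀ {r} (b : Fin r) c → S (unit b c)
    unit∈S {suc r} b = insertAt⁺ {P = S} b (λ _ → S-0) S-1

    span-generator : ∀ {t r} (w : Fin r → Vector t) b → InSpan S w (w b)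
    span-generator {r = suc r} w b =
      unit b , unit∈S b , (λ a → sym (lincomb-unit w b a))

    span-lincomb : ∀ {t r r′} (h : Fin r′ → Vector t) (w : Fin r → Vector t) (c : Fin r → Carrier) →
                   (∀ b → InSpan S h (w b)) → (∀ b → S (c b)) → InSpan S h (lincomb c w)
    span-lincomb {r = zero}  h w c w⊆h cs = span-zero h
    span-lincomb {r = suc r} h w c w⊆h cs =
      span-⊕ h (span-· h (c fzero) (cs fzero) (w⊆h fzero)) (span-lincomb h (tail w) (tail c) (w⊆h ∘ fsuc) (cs ∘ fsuc))

    span-⊆ : ∀ {t r r′} (h : Fin r′ → Vector t) (w : Fin r → Vector t) →
             (∀ b → InSpan S h (w b)) → ∀ {v} → InSpan S w v → InSpan S h v
    span-⊆ h w w⊆h (c , cs , e) = span-resp h (λ a → sym (e a)) (span-lincomb h w c w⊆h cs)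

    span-∷ : ∀ {t r} (w : Fin r → Vector t) u {v} → InSpan S w v → InSpan S (u ∷ w) v
    span-∷ w u (c , cs , e) =
      (0# ∷ c) , (λ { fzero → S-0 ; (fsuc b) → cs b }) ,
      (λ a → trans (e a) (sym (trans (cong (_+ lincomb c w a) (zeroˡ (u a))) (+-identityˡ _))))

    span-++ : ∀ {t r r′} (w : Fin r → Vector t) (w′ : Fin r′ → Vector t) {u v} →
              InSpan S w u → InSpan S w′ v → InSpan S (w ++ w′) (u ⊕ v)
    span-++ w w′ (c , cs , e) (c′ , cs′ , e′) =
      c ++ c′ , ++⁺ S cs cs′ , (λ a → trans (cong₂ _+_ (e a) (e′ a)) (sym (lincomb-++ c c′ w w′ a)))

    span-tail : ∀ {t r} (h : Fin (suc r) → Vector t) {v} (p : InSpan S h v) → proj₁ p fzero ≡ 0# →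
                InSpan S (tail h) v
    span-tail h (c , cs , e) c₀≡0 =
      tail c , cs ∘ fsuc ,
      (λ a → trans (e a) (trans (cong (_+ lincomb (tail c) (tail h) a)
                                      (trans (cong (_* h fzero a) c₀≡0) (zeroˡ _)))
                                (+-identityˡ _)))

    S-dot : ∀ {r} {e κ : Fin r → Carrier} → (∀ b → S (e b)) → (∀ b → S (κ b)) → S (dot e κ)
    S-dot {zero}  es κs = S-0
    S-dot {suc r} es κs = S-+ (S-* (es fzero) (κs fzero)) (S-dot (es ∘ fsuc) (κs ∘ fsuc))

    independent⇒nonzero : ∀ {t r} (w : Fin r → Vector t) → Independent S w → ∀ b → ¬ (w b ≋ zeroV)
    independent⇒nonzero {r = suc r} w ind b wb≋0 =
      1≢0 (trans (sym (insertAt-lookup _ b 1#))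
                 (ind (unit b) (unit∈S b) (λ a → trans (lincomb-unit w b a) (wb≋0 a)) b))

    independent-tail : ∀ {t r} (w : Fin (suc r) → Vector t) → Independent S w → Independent S (tail w)
    independent-tail w ind c cs e b =
      ind (0# ∷ c) (λ { fzero → S-0 ; (fsuc b) → cs b })
        (λ a → trans (cong (_+ lincomb c (tail w) a) (zeroˡ (w fzero a))) (trans (+-identityˡ _) (e a)))
        (fsuc b)

    independent-∷ : ∀ {t r} (w : Fin r → Vector t) {v} → Independent S w → ¬ InSpan S w v →
                    Independent S (v ∷ w)
    independent-∷ w {v} ind v∉w c cs e with c fzero ≟ 0#
    ... | yes c₀≡0 = λ
      { fzero    → c₀≡0
      ; (fsuc b) → ind (tail c) (cs ∘ fsuc)
          (λ a → trans (sym (trans (cong (_+ lincomb (tail c) w a)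
                                         (trans (cong (_* v a) c₀≡0) (zeroˡ (v a))))
                                   (+-identityˡ _)))
                       (e a))
          b }
    ... | no c₀≢0 with inverse (c fzero) c₀≢0
    ...   | y , c₀y≡1 = ⊥-elim (v∉w ((λ b → - y * c (fsuc b)) , (λ b → S-* (S-neg y∈S) (cs (fsuc b))) , v≋))
      where
      y∈S : S y
      y∈S = S-inv (cs fzero) c₀y≡1
      v≋ : v ≋ lincomb (λ b → - y * c (fsuc b)) w
      v≋ a = begin
        v a                             ≡⟨ sym (*-identityˡ (v a)) ⟩
        1# * v a                        ≡⟨ cong (_* v a) (sym (trans (*-comm y (c fzero)) c₀y≡1)) ⟩
        (y * c fzero) * v a             ≡⟨ *-assoc y (c fzero) (v a) ⟩
        y * (c fzero * v a)             ≡⟨ cong (y *_) (+-inverseˡ-unique _ _ (e a)) ⟩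
        y * - lincomb (tail c) w a      ≡⟨ sym (-‿distribʳ-* y _) ⟩
        - (y * lincomb (tail c) w a)    ≡⟨ -‿distribˡ-* y _ ⟩
        - y * lincomb (tail c) w a      ≡⟨ sym (lincomb-*ˡ (- y) (tail c) w a) ⟩
        lincomb (λ b → - y * c (fsuc b)) w a ∎

    hasDim⇒nonzero : ∀ {t a} {P : Sub t} → HasDim S P a → 1 ≤ a → ∃[ c ] (P c × ¬ (c ≋ zeroV))
    hasDim⇒nonzero {a = suc a} (w , w∈P , independent , _) _ =
      w fzero , w∈P fzero , independent⇒nonzero w independent fzero

    nonzero⇒hasDim≥1 : ∀ {t a} {P : Sub t} {c} → HasDim S P a → P c → ¬ (c ≋ zeroV) → 1 ≤ a
    nonzero⇒hasDim≥1 {a = zero}  (w , _ , _ , spans) Pc c≉0 = ⊥-elim (c≉0 (proj₂ (proj₂ (spans _ Pc))))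
    nonzero⇒hasDim≥1 {a = suc a} _ _ _ = s≤s z≤n

    span-hasDim : ∀ {t r a} (h : Fin r → Vector t) (σ : Fin a → Fin r) → Independent S (h ∘ σ) →
                  (∀ b → InSpan S (h ∘ σ) (h b)) → HasDim S (InSpan S h) a
    span-hasDim h σ independent spans =
      h ∘ σ , (λ b → span-generator h (σ b)) , independent , (λ _ → span-⊆ (h ∘ σ) h spans)

    _≋?_ : ∀ {t} (u v : Vector t) → Dec (u ≋ v)
    u ≋? v = Fin.all? (λ a → u a ≟ v a)

    -- Search over the finitely many S-values of the first coefficient.
    span? : ∀ {t r} (w : Fin r → Vector t) v → Dec (InSpan S w v)
    span? {r = zero} w v with v ≋? zeroV
    ... | yes v≋0 = yes ((λ ()) , (λ ()) , v≋0)
    ... | no v≉0  = no (λ (_ , _ , e) → v≉0 e)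
    span? {r = suc r} w v with any? (λ x → span? (tail w) (λ a → - (x * w fzero a) + v a)) elements
    ... | yes found with find found
    ...   | x , x∈ , (c , cs , e) =
            yes ((x ∷ c) , (λ { fzero → elements-sound x∈ ; (fsuc b) → cs b }) ,
                 (λ a → trans (sym (\\-leftDividesˡ _ _)) (cong (x * w fzero a +_) (e a))))
    span? {r = suc r} w v | no none =
      no (λ (c , cs , e) → none (lose (elements-complete (cs fzero))
                                      (tail c , cs ∘ fsuc , (λ a → sym (y≈x\\z _ _ _ (sym (e a)))))))

    independentSubfamily : ∀ {t r} (g : Fin r → Vector t) →
      Σ ℕ λ a → Σ (Fin a → Fin r) λ σ → a ≤ r × Independent S (g ∘ σ) × (∀ b → InSpan S (g ∘ σ) (g b))
    independentSubfamily {r = zero} g = 0 , (λ ()) , z≤n , (λ _ _ _ ()) , (λ ())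
    independentSubfamily {r = suc r} g with independentSubfamily (tail g)
    ... | a , σ , a≤r , ind , spans with span? (g ∘ fsuc ∘ σ) (g fzero)
    ...   | yes g₀∈ = a , fsuc ∘ σ , ℕ.m≤n⇒m≤1+n a≤r , ind , (λ { fzero → g₀∈ ; (fsuc b) → spans b })
    ...   | no g₀∉ =
            suc a , (fzero ∷ fsuc ∘ σ) , s≤s a≤r , independent-∷ (g ∘ fsuc ∘ σ) ind g₀∉ ,
            (λ { fzero → span-generator (g ∘ (fzero ∷ fsuc ∘ σ)) fzero ; (fsuc b) → span-∷ (g ∘ fsuc ∘ σ) (g fzero) (spans b) })

    independent-shear : ∀ {t a} (w : Fin (suc a) → Vector t) → Independent S w →
                        ∀ b₀ (κ : Fin a → Carrier) → (∀ s → S (κ s)) →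
                        Independent S (λ s → removeAt w b₀ s ⊕ (κ s · w b₀))
    independent-shear w ind b₀ κ κs e es e≋0 s =
      trans (sym (insertAt-punchIn e b₀ (dot e κ) s)) (ind E Es E≋0 (punchIn b₀ s))
      where
      E : Fin _ → Carrier
      E = insertAt e b₀ (dot e κ)
      Es : ∀ b → S (E b)
      Es = insertAt⁺ {P = S} b₀ es (S-dot es κs)
      E≋0 : lincomb E w ≋ zeroV
      E≋0 a = begin
        lincomb E w a
          ≡⟨ lincomb-removeAt E w b₀ a ⟩
        E b₀ * w b₀ a + lincomb (removeAt E b₀) (removeAt w b₀) a
          ≡⟨ cong₂ _+_ (cong (_* w b₀ a) (insertAt-lookup e b₀ _))
                       (lincomb-cong (insertAt-punchIn e b₀ _) (λ _ _ → refl) a) ⟩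
        dot e κ * w b₀ a + lincomb e (removeAt w b₀) a
          ≡⟨ +-comm _ _ ⟩
        lincomb e (removeAt w b₀) a + dot e κ * w b₀ a
          ≡⟨ sym (lincomb-shear e κ (removeAt w b₀) (w b₀) a) ⟩
        lincomb e (λ s → removeAt w b₀ s ⊕ (κ s · w b₀)) a
          ≡⟨ e≋0 a ⟩
        0# ∎

    exchange-pivot : ∀ {t a r} (h : Fin (suc r) → Vector t) (w : Fin (suc a) → Vector t) → Independent S w →
                     (w⊆h : ∀ b → InSpan S h (w b)) → ∀ b₀ → ¬ (proj₁ (w⊆h b₀) fzero ≡ 0#) →
                     Σ (Fin a → Vector t) λ w′ →
                       Independent S w′ × (∀ s → InSpan S (tail h) (w′ s)) × (∀ s → InSpan S w (w′ s))
    exchange-pivot h w ind w⊆h b₀ φ₀≢0 with inverse (proj₁ (w⊆h b₀) fzero) φ₀≢0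
    ... | y , φ₀y≡1 = w′ , independent-shear w ind b₀ κ κs , w′⊆tail-h , w′⊆w
      where
      φ : Fin _ → Carrier
      φ b = proj₁ (w⊆h b) fzero
      φ∈S : ∀ b → S (φ b)
      φ∈S b = proj₁ (proj₂ (w⊆h b)) fzero
      κ : Fin _ → Carrier
      κ s = - (φ (punchIn b₀ s) * y)
      κs : ∀ s → S (κ s)
      κs s = S-neg (S-* (φ∈S (punchIn b₀ s)) (S-inv (φ∈S b₀) φ₀y≡1))
      w′ : Fin _ → Vector _
      w′ s = removeAt w b₀ s ⊕ (κ s · w b₀)
      w′⊆w : ∀ s → InSpan S w (w′ s)
      w′⊆w s = span-⊕ w (span-generator w (punchIn b₀ s)) (span-· w (κ s) (κs s) (span-generator w b₀))
      -- κ is chosen so that the h₀-coefficient of w′ s cancels.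
      cancels : ∀ x → x + - (x * y) * φ b₀ ≡ 0#
      cancels x = begin
        x + - (x * y) * φ b₀      ≡⟨ cong (x +_) (sym (-‿distribˡ-* _ _)) ⟩
        x + - ((x * y) * φ b₀)    ≡⟨ cong (λ z → x + - z) (trans (*-assoc x y _) (cong (x *_) (trans (*-comm y _) φ₀y≡1))) ⟩
        x + - (x * 1#)            ≡⟨ cong (λ z → x + - z) (*-identityʳ x) ⟩
        x + - x                   ≡⟨ -‿inverseʳ x ⟩
        0# ∎
      w′⊆tail-h : ∀ s → InSpan S (tail h) (w′ s)
      w′⊆tail-h s = span-tail h (span-⊕ h (w⊆h (punchIn b₀ s)) (span-· h (κ s) (κs s) (w⊆h b₀)))
                              (cancels (φ (punchIn b₀ s)))

    exchange : ∀ {t a r} (h : Fin (suc r) → Vector t) (w : Fin (suc a) → Vector t) → Independent S w →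
               (∀ b → InSpan S h (w b)) →
               Σ (Fin a → Vector t) λ w′ →
                 Independent S w′ × (∀ s → InSpan S (tail h) (w′ s)) × (∀ s → InSpan S w (w′ s))
    exchange h w ind w⊆h with Fin.any? (λ b → ¬? (proj₁ (w⊆h b) fzero ≟ 0#))
    ... | yes (b₀ , φ₀≢0) = exchange-pivot h w ind w⊆h b₀ φ₀≢0
    ... | no none =
          tail w , independent-tail w ind ,
          (λ s → span-tail h (w⊆h (fsuc s)) (decidable-stable (_ ≟ _) (λ ≢0 → none (fsuc s , ≢0)))) ,
          (λ s → span-generator w (fsuc s))

    steinitz : ∀ {t a r} (h : Fin r → Vector t) (w : Fin a → Vector t) → Independent S w →
               (∀ b → InSpan S h (w b)) → a ≤ r
    steinitz {a = zero}              h w ind w⊆h = z≤n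
    steinitz {a = suc a} {r = zero}  h w ind w⊆h = ⊥-elim (independent⇒nonzero w ind fzero (proj₂ (proj₂ (w⊆h fzero))))
    steinitz {a = suc a} {r = suc r} h w ind w⊆h with exchange h w ind w⊆h
    ... | w′ , ind′ , w′⊆tail-h , _ = s≤s (steinitz (tail h) w′ ind′ w′⊆tail-h)

allFunctions : ∀ {A : Set} → List A → (r : ℕ) → List (Fin r → A)
allFunctions xs zero    = [ (λ ()) ]
allFunctions xs (suc r) = cartesianProductWith _∷_ xs (allFunctions xs r)

allFunctions-complete : ∀ {A : Set} (xs : List A) {r} (f : Fin r → A) → (∀ b → f b ∈ xs) →
                        ∃[ g ] (g ∈ allFunctions xs r × (∀ b → g b ≡ f b))
allFunctions-complete xs {zero}  f f∈xs = (λ ()) , here refl , (λ ())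
allFunctions-complete xs {suc r} f f∈xs with allFunctions-complete xs (tail f) (f∈xs ∘ fsuc)
... | g , g∈ , g≗f = (f fzero ∷ g) , ∈-cartesianProductWith⁺ _∷_ (f∈xs fzero) g∈ ,
                     (λ { fzero → refl ; (fsuc b) → g≗f b })

module FiniteExtension {q m} (L : Field) (E : SubfieldExtension L q m) where
  open Field L
  open LinAlg L
  open LinearCombinations L
  open SubfieldExtension E

  β : Fin m → Vector 1
  β = proj₁ degree

  β-spans : ∀ x → InSpan K β (λ _ → x)
  β-spans x = proj₂ (proj₂ (proj₂ degree)) (λ _ → x) tt

  coordinates : Carrier → Fin m → Fin q
  coordinates x b = proj₁ (proj₁ (proj₂ (β-spans x)) b)

  coordinates-spec : ∀ x → x ≡ lincomb (ι ∘ coordinates x) β fzero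
  coordinates-spec x =
    trans (proj₂ (proj₂ (β-spans x)) fzero)
          (lincomb-cong (λ b → sym (proj₂ (proj₁ (proj₂ (β-spans x)) b))) (λ _ _ → refl) fzero)

  _≟_ : DecidableEquality Carrier
  x ≟ y = map′ same-coordinates (λ x≡y b → cong (λ z → coordinates z b) x≡y)
               (Fin.all? (λ b → coordinates x b Fin.≟ coordinates y b))
    where
    same-coordinates : (∀ b → coordinates x b ≡ coordinates y b) → x ≡ y
    same-coordinates eq = trans (coordinates-spec x)
      (trans (lincomb-cong (λ b → cong ι (eq b)) (λ _ _ → refl) fzero) (sym (coordinates-spec y)))

  elements : List Carrier
  elements = List.map (λ f → lincomb (ι ∘ f) β fzero) (allFunctions (allFin q) m)

  elements-complete : ∀ x → x ∈ elements
  elements-complete x with allFunctions-complete (allFin q) (coordinates x) (λ b → ∈-allFin _)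
  ... | f , f∈ , f≗coordinates =
        subst (_∈ elements)
              (trans (lincomb-cong (λ b → cong ι (f≗coordinates b)) (λ _ _ → refl) fzero) (sym (coordinates-spec x)))
              (∈-map⁺ (λ f → lincomb (ι ∘ f) β fzero) f∈)

  open Spans L _≟_

  K-finite : IsFiniteSubfield K
  K-finite = record
    { S-0 = K-0 ; S-1 = K-1
    ; S-+ = K-+ _ _ ; S-* = K-* _ _ ; S-neg = K-neg _ ; S-inv = K-inv _ _
    ; elements          = List.map ι (allFin q)
    ; elements-sound    = λ x∈ → let (a , _ , x≡ιa) = ∈-map⁻ ι x∈ in a , sym x≡ιa
    ; elements-complete = λ (a , ιa≡x) → subst (_∈ List.map ι (allFin q)) ιa≡x (∈-map⁺ ι (∈-allFin a))
    }

  L-finite : IsFiniteSubfield AllScalars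
  L-finite = record
    { S-0 = tt ; S-1 = tt
    ; S-+ = λ _ _ → tt ; S-* = λ _ _ → tt ; S-neg = λ _ → tt ; S-inv = λ _ _ → tt
    ; elements          = elements
    ; elements-sound    = λ _ → tt
    ; elements-complete = λ _ → elements-complete _
    }

  module SpanK = FiniteSpans K-finite
  module SpanL = FiniteSpans L-finite

  -- A basis is extracted from the finitely many L-combinations of h that satisfy P.
  finiteDimensional : ∀ {t r} (P : Sub t) → (∀ v → Dec (P v)) → (∀ {u v} → u ≋ v → P u → P v) →
                      (h : Fin r → Vector t) → (∀ v → P v → InSpan AllScalars h v) →
                      ∃[ a ] HasDim AllScalars P a
  finiteDimensional {r = r} P P? P-resp h P⊆h = a , g ∘ σ , g∘σ∈P , independent , spans-P
    where
    combinations : List (Vector _)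
    combinations = List.map (λ c → lincomb c h) (allFunctions elements r)
    candidates : List (Vector _)
    candidates = filter P? combinations
    g : Fin (List.length candidates) → Vector _
    g = List.lookup candidates
    a : ℕ
    a = proj₁ (SpanL.independentSubfamily g)
    σ : Fin a → Fin (List.length candidates)
    σ = proj₁ (proj₂ (SpanL.independentSubfamily g))
    independent : Independent AllScalars (g ∘ σ)
    independent = proj₁ (proj₂ (proj₂ (proj₂ (SpanL.independentSubfamily g))))
    spans-g : ∀ b → InSpan AllScalars (g ∘ σ) (g b)
    spans-g = proj₂ (proj₂ (proj₂ (proj₂ (SpanL.independentSubfamily g))))
    g∘σ∈P : ∀ b → P (g (σ b))
    g∘σ∈P b = proj₂ (∈-filter⁻ P? {xs = combinations} (∈-lookup (σ b)))
    spans-P : ∀ v → P v → InSpan AllScalars (g ∘ σ) v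
    spans-P v Pv with P⊆h v Pv
    ... | c , _ , v≋ with allFunctions-complete elements c (λ _ → elements-complete _)
    ... | c′ , c′∈ , c′≗c = SpanL.span-resp (g ∘ σ) g[i]≋v (spans-g i)
      where
      combination≋v : lincomb c′ h ≋ v
      combination≋v x = trans (lincomb-cong c′≗c (λ _ _ → refl) x) (sym (v≋ x))
      v∈candidates : lincomb c′ h ∈ candidates
      v∈candidates = ∈-filter⁺ P? (∈-map⁺ (λ c → lincomb c h) c′∈) (P-resp (λ x → sym (combination≋v x)) Pv)
      i : Fin (List.length candidates)
      i = index v∈candidates
      g[i]≋v : g i ≋ v
      g[i]≋v x = trans (cong-app (sym (lookup-index v∈candidates)) x) (combination≋v x)

  open Rank K

  EntrySpan : ∀ {n} → ℕ → Vector n → Set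
  EntrySpan N v = Σ (Fin N → Vector 1) λ B → ∀ x → InSpan K B (entries v x)

  rankAtMost-mono : ∀ {n i i′} {v : Vector n} → i ≤ i′ → RankAtMost i v → RankAtMost i′ v
  rankAtMost-mono i≤i′ (r , r≤i , rank) = r , ℕ.≤-trans r≤i i≤i′ , rank

  entrySpan⇒rankAtMost : ∀ {n N} {v : Vector n} → EntrySpan N v → RankAtMost N v
  entrySpan⇒rankAtMost {v = v} (B , v∈B) with SpanK.independentSubfamily (entries v)
  ... | r , σ , _ , independent , spans =
        r , SpanK.steinitz B (entries v ∘ σ) independent (λ b → v∈B (σ b)) ,
        entries v ∘ σ , (λ b → SpanK.span-generator (entries v) (σ b)) , independent ,
        (λ u u∈ → SpanK.span-⊆ (entries v ∘ σ) (entries v) spans u∈)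

  hasRank⇒entrySpan : ∀ {n r} {v : Vector n} → HasRank v r → EntrySpan r v
  hasRank⇒entrySpan {v = v} (B , _ , _ , B-spans) =
    B , (λ x → B-spans (entries v x) (SpanK.span-generator (entries v) x))

  rankAtMost⇒entrySpan : ∀ {n i} {v : Vector n} → RankAtMost i v → ∃[ r ] (r ≤ i × EntrySpan r v)
  rankAtMost⇒entrySpan (r , r≤i , rank) = r , r≤i , hasRank⇒entrySpan rank

  entrySpan-resp : ∀ {n N} {u v : Vector n} → u ≋ v → EntrySpan N u → EntrySpan N v
  entrySpan-resp u≋v (B , u∈B) = B , (λ x → SpanK.span-resp B (λ _ → u≋v x) (u∈B x))

  entrySpan-· : ∀ {n N} {v : Vector n} c → EntrySpan N v → EntrySpan N (c · v)
  entrySpan-· c (B , v∈B) = (λ b → c · B b) , λ x →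
    let (e , es , v≋) = v∈B x
    in e , es , (λ a → trans (cong (c *_) (v≋ a)) (sym (lincomb-·ʳ c e B a)))

  entrySpan-⊕ : ∀ {n N N′} {u v : Vector n} → EntrySpan N u → EntrySpan N′ v → EntrySpan (N ℕ.+ N′) (u ⊕ v)
  entrySpan-⊕ (B , u∈B) (B′ , v∈B′) = B ++ B′ , (λ x → SpanK.span-++ B B′ (u∈B x) (v∈B′ x))

  entrySpan-split : ∀ {n} N {N′} {v : Vector n} → EntrySpan (N ℕ.+ N′) v →
                    Σ (Vector n) λ u₁ → Σ (Vector n) λ u₂ → EntrySpan N u₁ × EntrySpan N′ u₂ × v ≋ (u₁ ⊕ u₂)
  entrySpan-split {n} N {N′} {v} (B , v∈B) =
    u₁ , u₂ , (B ∘ (_↑ˡ N′) , λ x → coefficients x ∘ (_↑ˡ N′) , K-coefficients x ∘ (_↑ˡ N′) , λ { fzero → refl })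
            , (B ∘ (N ↑ʳ_)  , λ x → coefficients x ∘ (N ↑ʳ_)  , K-coefficients x ∘ (N ↑ʳ_)  , λ { fzero → refl })
            , λ x → trans (proj₂ (proj₂ (v∈B x)) fzero) (lincomb-split N (coefficients x) B fzero)
    where
    coefficients : Fin _ → Fin (N ℕ.+ N′) → Carrier
    coefficients x = proj₁ (v∈B x)
    K-coefficients : ∀ x b → K (coefficients x b)
    K-coefficients x = proj₁ (proj₂ (v∈B x))
    u₁ u₂ : Vector n
    u₁ x = lincomb (coefficients x ∘ (_↑ˡ N′)) (B ∘ (_↑ˡ N′)) fzero
    u₂ x = lincomb (coefficients x ∘ (N ↑ʳ_)) (B ∘ (N ↑ʳ_)) fzero

  entrySpan-lincomb : ∀ {n a} i (c : Fin a → Carrier) (h : Fin a → Vector n) → (∀ s → RankAtMost i (h s)) →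
                      ∃[ N ] (N ≤ a ℕ.* i × EntrySpan N (lincomb c h))
  entrySpan-lincomb {a = zero} i c h h-rank = 0 , z≤n , (λ ()) , (λ x → (λ ()) , (λ ()) , (λ _ → refl))
  entrySpan-lincomb {a = suc a} i c h h-rank
    with rankAtMost⇒entrySpan (h-rank fzero) | entrySpan-lincomb i (tail c) (tail h) (h-rank ∘ fsuc)
  ... | r , r≤i , h₀-span | N , N≤a*i , rest-span =
        r ℕ.+ N , ℕ.+-mono-≤ r≤i N≤a*i , entrySpan-⊕ (entrySpan-· (c fzero) h₀-span) rest-span

  rankAtMost-span : ∀ {n a} i (h : Fin a → Vector n) → (∀ s → RankAtMost i (h s)) →
                    ∀ {v} → InSpan AllScalars h v → RankAtMost (a ℕ.* i) v
  rankAtMost-span i h h-rank (c , _ , v≋) with entrySpan-lincomb i c h h-rank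
  ... | N , N≤a*i , span = rankAtMost-mono N≤a*i (entrySpan⇒rankAtMost (entrySpan-resp (λ x → sym (v≋ x)) span))

  -- Split off the part of v whose entries lie in the K-span of the first i elements; it has rank ≤ i.
  lowRankDecomposition : ∀ {n} i N {d} {v : Vector n} → d ≤ N ℕ.* i → EntrySpan d v →
    ∃[ N′ ] (N′ ≤ N × Σ (Fin N′ → Vector n) λ γ → (∀ s → RankAtMost i (γ s)) × InSpan AllScalars γ v)
  lowRankDecomposition i zero {zero} z≤n (B , v∈B) =
    0 , z≤n , (λ ()) , (λ ()) , (λ ()) , (λ ()) , (λ x → proj₂ (proj₂ (v∈B x)) fzero)
  lowRankDecomposition i (suc N) {d} {v} d≤ v-span with d ≤? i
  ... | yes d≤i =
        1 , s≤s z≤n , (λ _ → v) , (λ _ → rankAtMost-mono d≤i (entrySpan⇒rankAtMost v-span)) ,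
        SpanL.span-generator (λ _ → v) fzero
  ... | no d≰i with ℕ.m≤n⇒∃[o]m+o≡n (ℕ.<⇒≤ (ℕ.≰⇒> d≰i))
  ...   | d′ , refl with entrySpan-split i v-span
  ...     | u₁ , u₂ , u₁-span , u₂-span , v≋u₁⊕u₂
          with lowRankDecomposition i N (ℕ.+-cancelˡ-≤ i _ _ d≤) u₂-span
  ...       | N′ , N′≤N , γ , γ-rank , u₂∈γ =
              suc N′ , s≤s N′≤N , u₁ ∷ γ ,
              (λ { fzero → entrySpan⇒rankAtMost u₁-span ; (fsuc s) → γ-rank s }) ,
              SpanL.span-resp (u₁ ∷ γ) (λ x → sym (v≋u₁⊕u₂ x))
                (SpanL.span-⊕ (u₁ ∷ γ) (SpanL.span-generator (u₁ ∷ γ) fzero) (SpanL.span-∷ γ u₁ u₂∈γ))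

m≤⌈m/n⌉*n : ∀ m {n} → 1 ≤ n → m ≤ ceilDiv m n ℕ.* n
m≤⌈m/n⌉*n m {suc n′} _ = ℕ.+-cancelˡ-≤ n′ m (q ℕ.* suc n′) (begin
  n′ ℕ.+ m                              ≡⟨ ℕ.+-comm n′ m ⟩
  m ℕ.+ n′                              ≡⟨ m≡m%n+[m/n]*n (m ℕ.+ n′) (suc n′) ⟩
  (m ℕ.+ n′) % suc n′ ℕ.+ q ℕ.* suc n′  ≤⟨ ℕ.+-monoˡ-≤ (q ℕ.* suc n′) (ℕ.≤-pred (m%n<n (m ℕ.+ n′) (suc n′))) ⟩
  n′ ℕ.+ q ℕ.* suc n′                   ∎)
  where
  open ℕ.≤-Reasoning
  q : ℕ
  q = (m ℕ.+ n′) / suc n′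

m≤o*n⇒⌈m/n⌉≤o : ∀ m {n} o → 1 ≤ n → m ≤ o ℕ.* n → ceilDiv m n ≤ o
m≤o*n⇒⌈m/n⌉≤o m {suc n′} o _ m≤o*n =
  ℕ.≤-pred (m<n*o⇒m/o<n (s≤s (ℕ.≤-trans (ℕ.+-monoˡ-≤ n′ m≤o*n) (ℕ.≤-reflexive (ℕ.+-comm (o ℕ.* suc n′) n′)))))

module LatticeRankWeights {q m} (L : Field) (E : SubfieldExtension L q m) {n}
                          (C : LinAlg.Sub L n) (C-subspace : LinAlg.IsSubspace L C)
                          {k} (C-dim : LinAlg.HasDim L (LinAlg.AllScalars L) C k) (i : ℕ) where
  open LinAlg L
  open SubfieldExtension E using (K)
  open Rank K
  open FiniteExtension L E

  C-resp : ∀ {u v} → u ≋ v → C u → C v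
  C-resp = proj₂ (proj₂ (proj₂ C-subspace)) _ _

  C-span : ∀ {r} (w : Fin r → Vector n) → (∀ b → C (w b)) → ∀ {v} → InSpan AllScalars w v → C v
  C-span w w∈C (c , _ , v≋) = C-resp (λ x → sym (v≋ x)) (C-lincomb w c w∈C)
    where
    C-lincomb : ∀ {r} (w : Fin r → Vector n) c → (∀ b → C (w b)) → C (lincomb c w)
    C-lincomb {zero}  w c w∈C = proj₁ C-subspace
    C-lincomb {suc r} w c w∈C =
      proj₁ (proj₂ C-subspace) _ _ (proj₁ (proj₂ (proj₂ C-subspace)) (c fzero) (w fzero) (w∈C fzero))
                                   (C-lincomb (tail w) (tail c) (w∈C ∘ fsuc))

  C? : ∀ v → Dec (C v)
  C? v = map′ (C-span basis basis∈C) (basis-spans v) (SpanL.span? basis v)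
    where
    basis : Fin k → Vector n
    basis = proj₁ C-dim
    basis∈C : ∀ b → C (basis b)
    basis∈C = proj₁ (proj₂ C-dim)
    basis-spans : ∀ v → C v → InSpan AllScalars basis v
    basis-spans = proj₂ (proj₂ (proj₂ C-dim))

  C∩span-hasDim : ∀ {r} (h : Fin r → Vector n) → ∃[ a ] HasDim AllScalars (C ∩ InSpan AllScalars h) a
  C∩span-hasDim h =
    finiteDimensional (C ∩ InSpan AllScalars h) (λ v → C? v ×-dec SpanL.span? h v)
      (λ u≋v (u∈C , u∈h) → C-resp u≋v u∈C , SpanL.span-resp h u≋v u∈h)
      h (λ _ → proj₂)

  span-inLattice : ∀ {r} (h : Fin r → Vector n) → (∀ s → RankAtMost i (h s)) → InLattice i (InSpan AllScalars h)
  span-inLattice {r} h h-rank = r , h , h-rank , (λ v → (λ v∈ → v∈) , (λ v∈ → v∈))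

  record LowRankCover (X : Sub n) (a : ℕ) : Set where
    field
      size                   : ℕ
      size≤                  : size ≤ a
      generators             : Fin size → Vector n
      generators-rank        : ∀ s → RankAtMost i (generators s)
      generators-independent : Independent AllScalars generators
      covers                 : ∀ v → X v → InSpan AllScalars generators v

  lowRankCover : ∀ {X a} → InLattice i X → HasDim AllScalars X a → LowRankCover X a
  lowRankCover (r , g , g-rank , X⇔span) (w , _ , _ , w-spans) with SpanL.independentSubfamily g
  ... | a′ , σ , _ , independent , spans = record
    { size                   = a′
    ; size≤                  = SpanL.steinitz w (g ∘ σ) independent
                                 (λ b → w-spans _ (proj₂ (X⇔span _) (SpanL.span-generator g (σ b))))
    ; generators             = g ∘ σ
    ; generators-rank        = g-rank ∘ σ
    ; generators-independent = independent
    ; covers                 = λ v v∈X → SpanL.span-⊆ (g ∘ σ) g spans (proj₁ (X⇔span v) v∈X)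
    }

  ⌈d/i⌉≤weight₁ : ∀ {d w} → 1 ≤ i → IsMinRankDistance C d → IsLatticeRankWeight C i 1 w → ceilDiv d i ≤ w
  ⌈d/i⌉≤weight₁ {d} 1≤i (_ , d-minimal) ((X , X-lattice , X-dim , b , 1≤b , C∩X-dim) , _)
    with SpanL.hasDim⇒nonzero C∩X-dim 1≤b
  ... | c , (c∈C , c∈X) , c≉0 = m≤o*n⇒⌈m/n⌉≤o d _ 1≤i (ℕ.≤-trans d≤size*i (ℕ.*-monoˡ-≤ i size≤))
    where
    open LowRankCover (lowRankCover X-lattice X-dim)
    d≤size*i : d ≤ size ℕ.* i
    d≤size*i with rankAtMost-span i generators generators-rank (covers c c∈X)
    ... | r , r≤size*i , c-rank = ℕ.≤-trans (d-minimal c r c∈C c≉0 c-rank) r≤size*i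

  weight₁≤⌈d/i⌉ : ∀ {d w} → 1 ≤ i → IsMinRankDistance C d → IsLatticeRankWeight C i 1 w → w ≤ ceilDiv d i
  weight₁≤⌈d/i⌉ {d} 1≤i ((c , c∈C , c≉0 , c-rank) , _) (_ , w-minimal)
    with lowRankDecomposition i (ceilDiv d i) (m≤⌈m/n⌉*n d 1≤i) (hasRank⇒entrySpan c-rank)
  ... | N , N≤⌈d/i⌉ , γ , γ-rank , c∈γ with SpanL.independentSubfamily γ | C∩span-hasDim γ
  ... | a , σ , a≤N , independent , spans | a′ , C∩γ-dim =
        ℕ.≤-trans (w-minimal (InSpan AllScalars γ) a (span-inLattice γ γ-rank)
                             (SpanL.span-hasDim γ σ independent spans)
                             (a′ , SpanL.nonzero⇒hasDim≥1 C∩γ-dim (c∈C , c∈γ) c≉0 , C∩γ-dim))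
                  (ℕ.≤-trans a≤N N≤⌈d/i⌉)

  weight-strict : ∀ {j w w′} → IsLatticeRankWeight C i j w → IsLatticeRankWeight C i (suc j) w′ → w < w′
  weight-strict _ ((X , X-lattice , X-dim , suc b , _ , u , u∈C∩X , u-independent , _) , _)
    with lowRankCover X-lattice X-dim
  ... | record { size = zero ; generators = h ; covers = covers }
      with SpanL.steinitz h u u-independent (λ s → covers (u s) (proj₂ (u∈C∩X s)))
  ...   | ()
  weight-strict {w = w} (_ , w-minimal) ((X , X-lattice , X-dim , suc b , s≤s j≤b , u , u∈C∩X , u-independent , _) , _)
      | record { size = suc a ; size≤ = size≤ ; generators = h ; generators-rank = h-rank
               ; generators-independent = h-independent ; covers = covers }
      with SpanL.exchange h u u-independent (λ s → covers (u s) (proj₂ (u∈C∩X s)))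
  ...   | u′ , u′-independent , u′⊆tail-h , u′⊆u with C∩span-hasDim (tail h)
  ...   | a′ , C∩tail-h-dim@(basis , _ , _ , basis-spans) =
          ℕ.≤-trans (s≤s w≤a) size≤
    where
    u′∈C∩tail-h : ∀ s → (C ∩ InSpan AllScalars (tail h)) (u′ s)
    u′∈C∩tail-h s = C-span u (proj₁ ∘ u∈C∩X) (u′⊆u s) , u′⊆tail-h s
    b≤a′ : b ≤ a′
    b≤a′ = SpanL.steinitz basis u′ u′-independent (λ s → basis-spans (u′ s) (u′∈C∩tail-h s))
    w≤a : w ≤ a
    w≤a = w-minimal (InSpan AllScalars (tail h)) a (span-inLattice (tail h) (h-rank ∘ fsuc))
            (SpanL.span-hasDim (tail h) (λ s → s) (SpanL.independent-tail h h-independent)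
                                (SpanL.span-generator (tail h)))
            (a′ , ℕ.≤-trans j≤b b≤a′ , C∩tail-h-dim)

module _ (ℓ : ℕ → ℕ) {k} (ℓ-strict : ∀ j → 1 ≤ j → suc j ≤ k → ℓ j < ℓ (suc j)) where

  strict⇒gap : ∀ j t → 1 ≤ j → j ℕ.+ t ≤ k → ℓ j ℕ.+ t ≤ ℓ (j ℕ.+ t)
  strict⇒gap j zero    1≤j _ rewrite ℕ.+-identityʳ (ℓ j) | ℕ.+-identityʳ j = ℕ.≤-refl
  strict⇒gap j (suc t) 1≤j j+t<k rewrite ℕ.+-suc (ℓ j) t | ℕ.+-suc j t =
    ℕ.≤-trans (s≤s (strict⇒gap j t 1≤j (ℕ.<⇒≤ j+t<k))) (ℓ-strict (j ℕ.+ t) (ℕ.≤-trans 1≤j (ℕ.m≤m+n j t)) j+t<k)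

  strict∧tight⇒unitSteps : ℓ k ≡ ℓ 1 ℕ.+ (k ∸ 1) → ∀ j → 1 ≤ j → j ≤ k → ℓ j ≡ ℓ 1 ℕ.+ (j ∸ 1)
  strict∧tight⇒unitSteps tight (suc j) 1≤j j≤k with ℕ.m≤n⇒∃[o]m+o≡n j≤k
  ... | t , refl = ℕ.≤-antisym (ℕ.+-cancelʳ-≤ t _ _ upper) (strict⇒gap 1 j ℕ.≤-refl j≤k)
    where
    upper : ℓ (suc j) ℕ.+ t ≤ (ℓ 1 ℕ.+ j) ℕ.+ t
    upper = ℕ.≤-trans (strict⇒gap (suc j) t 1≤j ℕ.≤-refl)
                      (ℕ.≤-reflexive (trans tight (sym (ℕ.+-assoc (ℓ 1) j t))))

-- ℕ's _+_ only now: the field operations above are also called _+_.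
open import Data.Nat using (_+_)

proposition6p21 : (q m n : ℕ) → IsPrimePower q → 2 ≤ n → 2 ≤ m →
    (L : Field) → (E : SubfieldExtension L q m) →
    let open LinAlg L
        open Rank (SubfieldExtension.K E)
    in (C : Sub n) → IsSubspace C →
       (k : ℕ) → 1 ≤ k → HasDim AllScalars C k →
       (d : ℕ) → IsMinRankDistance C d →
       (i : ℕ) → 1 ≤ i → i ≤ n →
       (ℓ : ℕ → ℕ) → (∀ j → 1 ≤ j → j ≤ k → IsLatticeRankWeight C i j (ℓ j)) →
       ((ℓ k ≡ ℓ 1 + (k ∸ 1) × ℓ 1 + (k ∸ 1) ≡ ceilDiv d i + (k ∸ 1))
        ⇔ (∀ j → 1 ≤ j → j ≤ k → ℓ j ≡ ℓ 1 + (j ∸ 1)))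
proposition6p21 q m n _ _ _ L E C C-subspace k 1≤k C-dim d d-minimal i 1≤i _ ℓ ℓ-weight =
  mk⇔ (λ (tight , _) → strict∧tight⇒unitSteps ℓ ℓ-strict tight)
      (λ unitSteps → unitSteps k 1≤k ℕ.≤-refl , cong (_+ (k ∸ 1)) ℓ₁≡⌈d/i⌉)
  where
  open LatticeRankWeights L E C C-subspace C-dim i

  ℓ-strict : ∀ j → 1 ≤ j → suc j ≤ k → ℓ j < ℓ (suc j)
  ℓ-strict j 1≤j j<k = weight-strict (ℓ-weight j 1≤j (ℕ.<⇒≤ j<k)) (ℓ-weight (suc j) (s≤s z≤n) j<k)

  ℓ₁≡⌈d/i⌉ : ℓ 1 ≡ ceilDiv d i
  ℓ₁≡⌈d/i⌉ = ℕ.≤-antisym (weight₁≤⌈d/i⌉ 1≤i d-minimal (ℓ-weight 1 ℕ.≤-refl 1≤k))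
                           (⌈d/i⌉≤weight₁ 1≤i d-minimal (ℓ-weight 1 ℕ.≤-refl 1≤k))
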